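{- For all positive integers $n$ and $r$, $$F(n,r)=n^2F(n,r-1)-2n(2n-1)F(n-1,r-1),$$ where $F(n,r)=\sum_{k=-n}^{n}\binom{2n}{n-k}k^{2r}$ for nonnegative integers $n,r$.
   Context: The convention $0^0=1$ is used in the definition of $F$. -}

module Defs where

open import Data.Nat using (ℕ; zero; suc; _∸_)
open import Data.Nat.Combinatorics using (_C_)
open import Data.Integer using (ℤ; +_; _-_; _*_; _+_; _^_)

sumTo : ℕ → (ℕ → ℤ) → ℤ
sumTo zero    f = f zero
sumTo (suc m) f = sumTo m f + f (suc m)

-- F(n,r) = Σ_{k=-n}^{n} C(2n, n-k) k^{2r}, reindexed by j = k + n ∈ [0, 2n]:
-- k = j - n, n - k = 2n - j.  Uses 0^0 = 1 (as does ℤ's _^_).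
F : ℕ → ℕ → ℤ
F n r = sumTo (2 Data.Nat.* n) (λ j →
          (+ ((2 Data.Nat.* n) C ((2 Data.Nat.* n) ∸ j))) * ((+ j - + n) ^ (2 Data.Nat.* r)))

-- Writing x = j - c for the centred index, (c - x)(c + x) = j (2c - j), so
-- x^{2r+2} = c² x^{2r} - j (2c - j) x^{2r}.  Summed against C(2c, j), the
-- second term is handled by absorbing both factors into the binomial
-- coefficient: j (2c - j) C(2c, j) = 2c (2c - 1) C(2c - 2, j - 1), which turns
-- it into the moment sum for c - 1.
module Submission where

open import Defs
open import Data.Nat using (ℕ; zero; suc; _≤_; _∸_; z≤n; s≤s)
import Data.Nat as ℕ
import Data.Nat.Properties as ℕ
open import Data.Nat.Combinatorics
  using (_C_; nCk≡nC[n∸k]; nC1≡n; nCk+nC[k+1]≡[n+1]C[k+1]; k>n⇒nCk≡0)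
open import Data.Integer using (ℤ; +_; _+_; _-_; _*_; _^_)
open import Data.Integer.Properties
  using (pos-+; pos-*; +-assoc; *-assoc; *-distribˡ-+; +-identityˡ; +-identityʳ; m-n≡m⊖n; [1+m]⊖[1+n]≡m⊖n)
open import Data.Integer.Tactic.RingSolver using (solve-∀)
open import Relation.Nullary using (yes; no)
open import Relation.Binary.PropositionalEquality
  using (_≡_; refl; sym; trans; cong; cong₂; module ≡-Reasoning)

open ≡-Reasoning

sumTo-cong : ∀ m {f g : ℕ → ℤ} → (∀ j → j ≤ m → f j ≡ g j) → sumTo m f ≡ sumTo m g
sumTo-cong zero    f≗g = f≗g 0 z≤n
sumTo-cong (suc m) f≗g =
  cong₂ _+_ (sumTo-cong m (λ j j≤m → f≗g j (ℕ.m≤n⇒m≤1+n j≤m))) (f≗g (suc m) ℕ.≤-refl)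

sumTo-suc : ∀ m (f : ℕ → ℤ) → sumTo (suc m) f ≡ f 0 + sumTo m (λ j → f (suc j))
sumTo-suc zero    f = refl
sumTo-suc (suc m) f =
  trans (cong (_+ f (suc (suc m))) (sumTo-suc m f)) (+-assoc (f 0) _ _)

sumTo-*ˡ : ∀ m a (f : ℕ → ℤ) → sumTo m (λ j → a * f j) ≡ a * sumTo m f
sumTo-*ˡ zero    a f = refl
sumTo-*ˡ (suc m) a f =
  trans (cong (_+ a * f (suc m)) (sumTo-*ˡ m a f)) (sym (*-distribˡ-+ a (sumTo m f) (f (suc m))))

sumTo-- : ∀ m (f g : ℕ → ℤ) → sumTo m (λ j → f j - g j) ≡ sumTo m f - sumTo m g
sumTo-- zero    f g = refl
sumTo-- (suc m) f g =
  trans (cong (_+ (f (suc m) - g (suc m))) (sumTo-- m f g)) (interchange (sumTo m f) _ _ _)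
  where
  interchange : ∀ a b c d → (a - b) + (c - d) ≡ (a + c) - (b + d)
  interchange = solve-∀

[k+1]*[n+1]C[k+1]≡[n+1]*nCk : ∀ n k → suc k ℕ.* (suc n C suc k) ≡ suc n ℕ.* (n C k)
[k+1]*[n+1]C[k+1]≡[n+1]*nCk zero zero = refl
[k+1]*[n+1]C[k+1]≡[n+1]*nCk zero (suc k)
  rewrite k>n⇒nCk≡0 {1} {suc (suc k)} (s≤s (s≤s z≤n)) | k>n⇒nCk≡0 {0} {suc k} (s≤s z≤n) =
  ℕ.*-zeroʳ k
[k+1]*[n+1]C[k+1]≡[n+1]*nCk (suc n) zero =
  trans (ℕ.+-identityʳ _) (trans (nC1≡n (suc (suc n))) (sym (ℕ.*-identityʳ (suc (suc n)))))
[k+1]*[n+1]C[k+1]≡[n+1]*nCk (suc n) (suc k) = begin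
  suc (suc k) ℕ.* (suc (suc n) C suc (suc k))
    ≡⟨ cong (suc (suc k) ℕ.*_) (sym (nCk+nC[k+1]≡[n+1]C[k+1] (suc n) (suc k))) ⟩
  suc (suc k) ℕ.* (suc n C suc k ℕ.+ suc n C suc (suc k))
    ≡⟨ ℕ.*-distribˡ-+ (suc (suc k)) (suc n C suc k) (suc n C suc (suc k)) ⟩
  suc n C suc k ℕ.+ suc k ℕ.* (suc n C suc k) ℕ.+ suc (suc k) ℕ.* (suc n C suc (suc k))
    ≡⟨ cong₂ (λ u v → suc n C suc k ℕ.+ u ℕ.+ v)
         ([k+1]*[n+1]C[k+1]≡[n+1]*nCk n k) ([k+1]*[n+1]C[k+1]≡[n+1]*nCk n (suc k)) ⟩
  suc n C suc k ℕ.+ suc n ℕ.* (n C k) ℕ.+ suc n ℕ.* (n C suc k)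
    ≡⟨ ℕ.+-assoc (suc n C suc k) _ _ ⟩
  suc n C suc k ℕ.+ (suc n ℕ.* (n C k) ℕ.+ suc n ℕ.* (n C suc k))
    ≡⟨ cong (suc n C suc k ℕ.+_) (sym (ℕ.*-distribˡ-+ (suc n) (n C k) (n C suc k))) ⟩
  suc n C suc k ℕ.+ suc n ℕ.* (n C k ℕ.+ n C suc k)
    ≡⟨ cong (λ u → suc n C suc k ℕ.+ suc n ℕ.* u) (nCk+nC[k+1]≡[n+1]C[k+1] n k) ⟩
  suc (suc n) ℕ.* (suc n C suc k)
    ∎

[k+1][m+1∸k]*[m+2]C[k+1]≡[m+2][m+1]*mCk : ∀ m k →
  suc k ℕ.* (suc m ∸ k) ℕ.* (suc (suc m) C suc k) ≡ suc (suc m) ℕ.* suc m ℕ.* (m C k)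
[k+1][m+1∸k]*[m+2]C[k+1]≡[m+2][m+1]*mCk m k with k ℕ.≤? m
... | yes k≤m = begin
  suc k ℕ.* (suc m ∸ k) ℕ.* (suc (suc m) C suc k)
    ≡⟨ cong (λ t → suc k ℕ.* t ℕ.* (suc (suc m) C suc k)) [m+1]∸k≡1+l ⟩
  suc k ℕ.* suc l ℕ.* (suc (suc m) C suc k)
    ≡⟨ rearrange (suc k) (suc l) (suc (suc m) C suc k) ⟩
  suc l ℕ.* (suc k ℕ.* (suc (suc m) C suc k))
    ≡⟨ cong (suc l ℕ.*_) ([k+1]*[n+1]C[k+1]≡[n+1]*nCk (suc m) k) ⟩
  suc l ℕ.* (suc (suc m) ℕ.* (suc m C k))
    ≡⟨ cong (λ t → suc l ℕ.* (suc (suc m) ℕ.* t)) (trans (nCk≡nC[n∸k] (ℕ.m≤n⇒m≤1+n k≤m)) (cong (suc m C_) [m+1]∸k≡1+l)) ⟩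
  suc l ℕ.* (suc (suc m) ℕ.* (suc m C suc l))
    ≡⟨ rearrange′ (suc l) (suc (suc m)) (suc m C suc l) ⟩
  suc (suc m) ℕ.* (suc l ℕ.* (suc m C suc l))
    ≡⟨ cong (suc (suc m) ℕ.*_) ([k+1]*[n+1]C[k+1]≡[n+1]*nCk m l) ⟩
  suc (suc m) ℕ.* (suc m ℕ.* (m C l))
    ≡⟨ cong (λ t → suc (suc m) ℕ.* (suc m ℕ.* t)) (sym (nCk≡nC[n∸k] k≤m)) ⟩
  suc (suc m) ℕ.* (suc m ℕ.* (m C k))
    ≡⟨ sym (ℕ.*-assoc (suc (suc m)) (suc m) (m C k)) ⟩
  suc (suc m) ℕ.* suc m ℕ.* (m C k)
    ∎
  where
  l = m ∸ k
  [m+1]∸k≡1+l : suc m ∸ k ≡ suc l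
  [m+1]∸k≡1+l = ℕ.+-∸-assoc 1 k≤m
  rearrange : ∀ a b c → a ℕ.* b ℕ.* c ≡ b ℕ.* (a ℕ.* c)
  rearrange a b c = trans (cong (ℕ._* c) (ℕ.*-comm a b)) (ℕ.*-assoc b a c)
  rearrange′ : ∀ a b c → a ℕ.* (b ℕ.* c) ≡ b ℕ.* (a ℕ.* c)
  rearrange′ a b c = trans (sym (ℕ.*-assoc a b c)) (rearrange a b c)
... | no k≰m = begin
  suc k ℕ.* (suc m ∸ k) ℕ.* (suc (suc m) C suc k)
    ≡⟨ cong (λ t → suc k ℕ.* t ℕ.* (suc (suc m) C suc k)) (ℕ.m≤n⇒m∸n≡0 m<k) ⟩
  suc k ℕ.* 0 ℕ.* (suc (suc m) C suc k)
    ≡⟨ cong (ℕ._* (suc (suc m) C suc k)) (ℕ.*-zeroʳ (suc k)) ⟩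
  0
    ≡⟨ sym (ℕ.*-zeroʳ (suc (suc m) ℕ.* suc m)) ⟩
  suc (suc m) ℕ.* suc m ℕ.* 0
    ≡⟨ cong (suc (suc m) ℕ.* suc m ℕ.*_) (sym (k>n⇒nCk≡0 m<k)) ⟩
  suc (suc m) ℕ.* suc m ℕ.* (m C k)
    ∎
  where
  m<k = ℕ.≰⇒> k≰m

momentTerm : ℕ → ℕ → ℕ → ℕ → ℤ
momentTerm M c r j = + (M C j) * (+ j - + c) ^ (2 ℕ.* r)

binomialMoment : ℕ → ℕ → ℕ → ℤ
binomialMoment M c r = sumTo M (momentTerm M c r)

weightedTerm : ℕ → ℕ → ℕ → ℕ → ℤ
weightedTerm M c r j = + (j ℕ.* (M ∸ j) ℕ.* (M C j)) * (+ j - + c) ^ (2 ℕ.* r)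

weightedMoment : ℕ → ℕ → ℕ → ℤ
weightedMoment M c r = sumTo M (weightedTerm M c r)

F≡binomialMoment : ∀ n r → F n r ≡ binomialMoment (2 ℕ.* n) n r
F≡binomialMoment n r = sumTo-cong (2 ℕ.* n) λ j j≤2n →
  cong (λ k → + k * (+ j - + n) ^ (2 ℕ.* r)) (sym (nCk≡nC[n∸k] j≤2n))

binomialMoment-extend : ∀ m c r → sumTo (suc m) (momentTerm m c r) ≡ binomialMoment m c r
binomialMoment-extend m c r =
  trans (cong (λ k → binomialMoment m c r + + k * (+ suc m - + c) ^ (2 ℕ.* r)) (k>n⇒nCk≡0 (ℕ.n<1+n m)))
        (+-identityʳ (binomialMoment m c r))

centred-square : ∀ c j k B y → j + k ≡ + 2 * c →
  B * ((j - c) * ((j - c) * y)) ≡ c ^ 2 * (B * y) - j * k * B * y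
centred-square c j k B y j+k≡2c = begin
  B * ((j - c) * ((j - c) * y))
    ≡⟨ expand c j k B y ⟩
  c ^ 2 * (B * y) - j * k * B * y + (j + k - + 2 * c) * (j * B * y)
    ≡⟨ cong (λ s → c ^ 2 * (B * y) - j * k * B * y + (s - + 2 * c) * (j * B * y)) j+k≡2c ⟩
  c ^ 2 * (B * y) - j * k * B * y + (+ 2 * c - + 2 * c) * (j * B * y)
    ≡⟨ cancel (c ^ 2 * (B * y) - j * k * B * y) (+ 2 * c) (j * B * y) ⟩
  c ^ 2 * (B * y) - j * k * B * y
    ∎
  where
  expand : ∀ c j k B y → B * ((j - c) * ((j - c) * y))
                       ≡ c * (c * + 1) * (B * y) - j * k * B * y + (j + k - + 2 * c) * (j * B * y)
  expand = solve-∀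
  cancel : ∀ a t u → a + (t - t) * u ≡ a
  cancel = solve-∀

momentTerm-suc : ∀ {M c} r j → M ≡ 2 ℕ.* c → j ≤ M →
  momentTerm M c (suc r) j ≡ (+ c) ^ 2 * momentTerm M c r j - weightedTerm M c r j
momentTerm-suc {M} {c} r j refl j≤M = begin
  B * x ^ (2 ℕ.* suc r)
    ≡⟨ cong (λ e → B * x ^ e) (ℕ.*-suc 2 r) ⟩
  B * (x * (x * y))
    ≡⟨ centred-square (+ c) (+ j) (+ (M ∸ j)) B y j+[M∸j]≡2c ⟩
  (+ c) ^ 2 * (B * y) - + j * + (M ∸ j) * B * y
    ≡⟨ cong (λ w → (+ c) ^ 2 * (B * y) - w * y) (sym weight-pos) ⟩
  (+ c) ^ 2 * (B * y) - + (j ℕ.* (M ∸ j) ℕ.* (M C j)) * y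
    ∎
  where
  B = + (M C j)
  x = + j - + c
  y = x ^ (2 ℕ.* r)
  j+[M∸j]≡2c : + j + + (M ∸ j) ≡ + 2 * + c
  j+[M∸j]≡2c = trans (sym (pos-+ j (M ∸ j))) (trans (cong +_ (ℕ.m+[n∸m]≡n j≤M)) (pos-* 2 c))
  weight-pos : + (j ℕ.* (M ∸ j) ℕ.* (M C j)) ≡ + j * + (M ∸ j) * B
  weight-pos = trans (pos-* (j ℕ.* (M ∸ j)) (M C j)) (cong (_* B) (pos-* j (M ∸ j)))

binomialMoment-suc : ∀ M c r → M ≡ 2 ℕ.* c →
  binomialMoment M c (suc r) ≡ (+ c) ^ 2 * binomialMoment M c r - weightedMoment M c r
binomialMoment-suc M c r M≡2c = begin
  binomialMoment M c (suc r)
    ≡⟨ sumTo-cong M (λ j → momentTerm-suc {M} {c} r j M≡2c) ⟩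
  sumTo M (λ j → (+ c) ^ 2 * momentTerm M c r j - weightedTerm M c r j)
    ≡⟨ sumTo-- M _ _ ⟩
  sumTo M (λ j → (+ c) ^ 2 * momentTerm M c r j) - weightedMoment M c r
    ≡⟨ cong (_- weightedMoment M c r) (sumTo-*ˡ M ((+ c) ^ 2) (momentTerm M c r)) ⟩
  (+ c) ^ 2 * binomialMoment M c r - weightedMoment M c r
    ∎

+[1+i]-+[1+c]≡+i-+c : ∀ i c → + suc i - + suc c ≡ + i - + c
+[1+i]-+[1+c]≡+i-+c i c = trans ([1+m]⊖[1+n]≡m⊖n i c) (sym (m-n≡m⊖n i c))

weightedMoment≡binomialMoment : ∀ {M} m c r → M ≡ suc (suc m) →
  weightedMoment M (suc c) r ≡ + (M ℕ.* suc m) * binomialMoment m c r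
weightedMoment≡binomialMoment {M} m c r refl = begin
  weightedMoment M (suc c) r
    ≡⟨ sumTo-suc (suc m) (weightedTerm M (suc c) r) ⟩
  + 0 + sumTo (suc m) (λ i → weightedTerm M (suc c) r (suc i))
    ≡⟨ +-identityˡ _ ⟩
  sumTo (suc m) (λ i → weightedTerm M (suc c) r (suc i))
    ≡⟨ sumTo-cong (suc m) (λ i _ → shifted-term i) ⟩
  sumTo (suc m) (λ i → + (M ℕ.* suc m) * momentTerm m c r i)
    ≡⟨ sumTo-*ˡ (suc m) (+ (M ℕ.* suc m)) (momentTerm m c r) ⟩
  + (M ℕ.* suc m) * sumTo (suc m) (momentTerm m c r)
    ≡⟨ cong (+ (M ℕ.* suc m) *_) (binomialMoment-extend m c r) ⟩
  + (M ℕ.* suc m) * binomialMoment m c r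
    ∎
  where
  shifted-term : ∀ i → weightedTerm M (suc c) r (suc i) ≡ + (M ℕ.* suc m) * momentTerm m c r i
  shifted-term i = begin
    + (suc i ℕ.* (suc m ∸ i) ℕ.* (M C suc i)) * (+ suc i - + suc c) ^ (2 ℕ.* r)
      ≡⟨ cong₂ (λ w x → + w * x ^ (2 ℕ.* r))
           ([k+1][m+1∸k]*[m+2]C[k+1]≡[m+2][m+1]*mCk m i) (+[1+i]-+[1+c]≡+i-+c i c) ⟩
    + (M ℕ.* suc m ℕ.* (m C i)) * (+ i - + c) ^ (2 ℕ.* r)
      ≡⟨ cong (_* (+ i - + c) ^ (2 ℕ.* r)) (pos-* (M ℕ.* suc m) (m C i)) ⟩
    + (M ℕ.* suc m) * + (m C i) * (+ i - + c) ^ (2 ℕ.* r)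
      ≡⟨ *-assoc (+ (M ℕ.* suc m)) (+ (m C i)) ((+ i - + c) ^ (2 ℕ.* r)) ⟩
    + (M ℕ.* suc m) * momentTerm m c r i
      ∎

+[2[n+1][2n+1]]≡2[n+1][2[n+1]-1] : ∀ n →
  + (2 ℕ.* suc n ℕ.* suc (2 ℕ.* n)) ≡ + 2 * + suc n * (+ 2 * + suc n - + 1)
+[2[n+1][2n+1]]≡2[n+1][2[n+1]-1] n =
  trans (pos-* (2 ℕ.* suc n) (suc (2 ℕ.* n))) (cong₂ _*_ (pos-* 2 (suc n)) 2n+1≡2[n+1]-1)
  where
  2n+1≡2[n+1]-1 : + suc (2 ℕ.* n) ≡ + 2 * + suc n - + 1
  2n+1≡2[n+1]-1 = cong (_- + 1) (trans (cong +_ (sym (ℕ.*-suc 2 n))) (pos-* 2 (suc n)))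

lemma2p2 : (n r : ℕ) →
    F (suc n) (suc r) ≡ (+ suc n) ^ 2 * F (suc n) r - (+ 2) * (+ suc n) * ((+ 2) * (+ suc n) - + 1) * F n r
lemma2p2 n r = begin
  F (suc n) (suc r)
    ≡⟨ F≡binomialMoment (suc n) (suc r) ⟩
  binomialMoment M (suc n) (suc r)
    ≡⟨ binomialMoment-suc M (suc n) r refl ⟩
  (+ suc n) ^ 2 * binomialMoment M (suc n) r - weightedMoment M (suc n) r
    ≡⟨ cong₂ (λ a b → (+ suc n) ^ 2 * a - b) (sym (F≡binomialMoment (suc n) r))
             (weightedMoment≡binomialMoment (2 ℕ.* n) n r (ℕ.*-suc 2 n)) ⟩
  (+ suc n) ^ 2 * F (suc n) r - + (M ℕ.* suc (2 ℕ.* n)) * binomialMoment (2 ℕ.* n) n r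
    ≡⟨ cong₂ (λ a b → (+ suc n) ^ 2 * F (suc n) r - a * b)
             (+[2[n+1][2n+1]]≡2[n+1][2[n+1]-1] n) (sym (F≡binomialMoment n r)) ⟩
  (+ suc n) ^ 2 * F (suc n) r - (+ 2) * (+ suc n) * ((+ 2) * (+ suc n) - + 1) * F n r
    ∎
  where
  M = 2 ℕ.* suc n
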